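{- Let $p$ be a pattern of length $\ell\ge(q+1)s+t$ having periods $s<t$. Then $t-s$ is also a period of $p$.
   Context: Let $\mathcal{A}$ be a finite alphabet with $q$ letters and $G$ a subgroup of the symmetric group on $\mathcal{A}$, acting on words letterwise. A pattern is a $G$-orbit of words, represented by its lexicographically least word $p=p(1)\cdots p(\ell)$, with $p(i,j)=p(i)\cdots p(j)$. A pattern $p$ of length $\ell$ has period $i$ ($1\le i\le\ell-1$) if there exists $g\in G$ with $g\cdot p(1,\ell-i)=p(i+1,\ell)$. -}

module Defs where

open import Level using (0ℓ)
open import Data.Nat using (ℕ; suc; _+_; _≤_; _<_)
open import Data.Fin using (Fin; toℕ) renaming (_<_ to _<ᶠ_)
open import Data.Fin.Permutation using (Permutation′; _⟨$⟩ʳ_; id; flip; _∘ₚ_; _≈_)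
open import Data.Product using (Σ; _×_; ∃)
open import Data.Sum using (_⊎_)
open import Relation.Binary.PropositionalEquality using (_≡_)

Word : ℕ → ℕ → Set
Word q ℓ = Fin ℓ → Fin q

record Subgroup (q : ℕ) : Set₁ where
  field
    mem     : Permutation′ q → Set
    resp    : ∀ {π σ} → π ≈ σ → mem π → mem σ
    has-id  : mem id
    has-∘   : ∀ {π σ} → mem π → mem σ → mem (π ∘ₚ σ)
    has-inv : ∀ {π} → mem π → mem (flip π)
open Subgroup public

act : ∀ {q ℓ} → Permutation′ q → Word q ℓ → Word q ℓ
act g w k = g ⟨$⟩ʳ w k

_≤lex_ : ∀ {q ℓ} → Word q ℓ → Word q ℓ → Set
_≤lex_ {q} {ℓ} u v =
  (∀ k → u k ≡ v k) ⊎
  Σ (Fin ℓ) (λ k → (∀ j → toℕ j < toℕ k → u j ≡ v j) × (u k <ᶠ v k))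

IsPattern : ∀ {q ℓ} → Subgroup q → Word q ℓ → Set
IsPattern G p = ∀ g → mem G g → p ≤lex act g p

-- p has period i (1 ≤ i ≤ ℓ-1): some g ∈ G maps p(1,ℓ-i) onto p(i+1,ℓ);
-- 0-indexed: g (p k) = p j whenever j = k + i.
HasPeriod : ∀ {q ℓ} → Subgroup q → Word q ℓ → ℕ → Set
HasPeriod {q} {ℓ} G p i =
  1 ≤ i × suc i ≤ ℓ ×
  Σ (Permutation′ q) (λ g → mem G g ×
    (∀ (k j : Fin ℓ) → toℕ j ≡ toℕ k + i → g ⟨$⟩ʳ p k ≡ p j))

-- Let g and h be letter permutations witnessing the periods s and t, and
-- u = t - s. At every position k ≥ s, h g⁻¹ carries p(k) to p(k+u); at every
-- position with k + t < ℓ, so does g⁻¹ h. For k < s the q+1 letters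
-- p(k), p(k+s), ..., p(k+qs) cannot be distinct, and cancelling g shows
-- p(k) = p(k+ds) for some 1 ≤ d ≤ q. At position k+ds both maps apply, so they
-- agree on the letter p(k), and h g⁻¹ witnesses the period u everywhere.
module Submission where

open import Defs
open import Data.Nat using (ℕ; zero; suc; _+_; _*_; _∸_; _≤_; _<_; s≤s)
open import Data.Nat.Properties
open import Data.Fin using (Fin; toℕ; fromℕ<)
open import Data.Fin.Properties using (toℕ<n; toℕ-fromℕ<; toℕ-injective; pigeonhole)
open import Data.Fin.Permutation using (Permutation′; _⟨$⟩ʳ_; _⟨$⟩ˡ_; flip; _∘ₚ_; inverseˡ)
open import Data.Product using (Σ; _×_; _,_; proj₁; proj₂)
open import Relation.Nullary using (yes; no)
open import Relation.Binary.PropositionalEquality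

Translates : ∀ {q ℓ} → Permutation′ q → Word q ℓ → ℕ → Set
Translates {ℓ = ℓ} g p i = ∀ (k j : Fin ℓ) → toℕ j ≡ toℕ k + i → g ⟨$⟩ʳ p k ≡ p j

lower : ∀ {ℓ} (x : Fin ℓ) (n : ℕ) → n ≤ toℕ x → Σ (Fin ℓ) λ y → toℕ y ≡ n
lower x n n≤x = fromℕ< (≤-<-trans n≤x (toℕ<n x)) , toℕ-fromℕ< _

offset< : ∀ {x s a q} → x < s → a ≤ q → x + a * s < suc q * s
offset< {a = a} x<s a≤q = <-≤-trans (+-monoˡ-< (a * _) x<s) (*-monoˡ-≤ _ (s≤s a≤q))

step-offset : ∀ {ℓ s} i {a a′ : Fin ℓ} → toℕ a′ ≡ toℕ a + suc i * s →
              Σ (Fin ℓ) λ a₁ → toℕ a₁ ≡ toℕ a + s × toℕ a′ ≡ toℕ a₁ + i * s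
step-offset {s = s} i {a} {a′} ea =
  proj₁ a₁ , proj₂ a₁ , trans split (cong (_+ i * s) (sym (proj₂ a₁)))
  where
    split : toℕ a′ ≡ (toℕ a + s) + i * s
    split = trans ea (sym (+-assoc (toℕ a) s (i * s)))
    a₁ = lower a′ (toℕ a + s) (subst (toℕ a + s ≤_) (sym split) (m≤m+n _ _))

offset-position : ∀ {q ℓ s} → suc q * s ≤ ℓ → (k : Fin ℓ) → toℕ k < s → (a : ℕ) → a ≤ q → Fin ℓ
offset-position qs≤ℓ k k<s a a≤q = fromℕ< (<-≤-trans (offset< k<s a≤q) qs≤ℓ)

module _ {q ℓ} {p : Word q ℓ} {s : ℕ} (g : Permutation′ q) (gp : Translates g p s) where

  translate⁻¹ : ∀ {k j} → toℕ j ≡ toℕ k + s → g ⟨$⟩ˡ p j ≡ p k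
  translate⁻¹ {k} {j} e = trans (cong (g ⟨$⟩ˡ_) (sym (gp k j e))) (inverseˡ g)

  cancel-translate : ∀ {a b a′ b′} → toℕ a′ ≡ toℕ a + s → toℕ b′ ≡ toℕ b + s →
                     p a′ ≡ p b′ → p a ≡ p b
  cancel-translate ea eb e =
    trans (sym (translate⁻¹ ea)) (trans (cong (g ⟨$⟩ˡ_) e) (translate⁻¹ eb))

  cancel-translates : ∀ i {a b a′ b′} → toℕ a′ ≡ toℕ a + i * s → toℕ b′ ≡ toℕ b + i * s →
                      p a′ ≡ p b′ → p a ≡ p b
  cancel-translates zero ea eb e =
    trans (cong p (toℕ-injective (sym (trans ea (+-identityʳ _)))))
          (trans e (cong p (toℕ-injective (trans eb (+-identityʳ _)))))
  cancel-translates (suc i) ea eb e with step-offset i ea | step-offset i eb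
  ... | a₁ , ea₁ , ea′ | b₁ , eb₁ , eb′ =
    cancel-translate ea₁ eb₁ (cancel-translates i ea′ eb′ e)

  letter-recurs : suc q * s ≤ ℓ → (k : Fin ℓ) → toℕ k < s →
                  Σ ℕ λ d → 1 ≤ d × d ≤ q × Σ (Fin ℓ) λ y → toℕ y ≡ toℕ k + d * s × p k ≡ p y
  letter-recurs qs≤ℓ k k<s
    with pigeonhole (n<1+n q) (λ i → p (position (toℕ i) (≤-pred (toℕ<n i))))
    where position = offset-position qs≤ℓ k k<s
  ... | i , j , i<j , pᵢ≡pⱼ =
    d , m<n⇒0<n∸m i<j , d≤q , y , toℕ-fromℕ< _ ,
    cancel-translates (toℕ i) (toℕ-fromℕ< _) jth pᵢ≡pⱼ
    where
      open ≡-Reasoning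
      d = toℕ j ∸ toℕ i
      d≤q : d ≤ q
      d≤q = ≤-trans (m∸n≤m (toℕ j) (toℕ i)) (≤-pred (toℕ<n j))
      y = offset-position qs≤ℓ k k<s d d≤q
      jth : toℕ (offset-position qs≤ℓ k k<s (toℕ j) (≤-pred (toℕ<n j))) ≡ toℕ y + toℕ i * s
      jth = begin
        toℕ (fromℕ< _)                    ≡⟨ toℕ-fromℕ< _ ⟩
        toℕ k + toℕ j * s                 ≡⟨ cong (λ z → toℕ k + z * s) (sym (m∸n+n≡m (<⇒≤ i<j))) ⟩
        toℕ k + (d + toℕ i) * s           ≡⟨ cong (toℕ k +_) (*-distribʳ-+ s d (toℕ i)) ⟩
        toℕ k + (d * s + toℕ i * s)       ≡⟨ sym (+-assoc (toℕ k) (d * s) (toℕ i * s)) ⟩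
        (toℕ k + d * s) + toℕ i * s       ≡⟨ cong (_+ toℕ i * s) (sym (toℕ-fromℕ< _)) ⟩
        toℕ y + toℕ i * s                 ∎

module _ {q ℓ} {p : Word q ℓ} {s t : ℕ} (g h : Permutation′ q) (s<t : s < t)
         (bound : suc q * s + t ≤ ℓ) (gp : Translates g p s) (hp : Translates h p t) where

  private
    u = t ∸ s

  translate-difference-late : ∀ {k j : Fin ℓ} → s ≤ toℕ k → toℕ j ≡ toℕ k + u →
                              h ⟨$⟩ʳ (g ⟨$⟩ˡ p k) ≡ p j
  translate-difference-late {k} {j} s≤k e with lower k (toℕ k ∸ s) (m∸n≤m (toℕ k) s)
  ... | m , em = trans (cong (h ⟨$⟩ʳ_) (translate⁻¹ g gp k≡m+s)) (hp m j j≡m+t)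
    where
      open ≡-Reasoning
      k≡m+s : toℕ k ≡ toℕ m + s
      k≡m+s = trans (sym (m∸n+n≡m s≤k)) (cong (_+ s) (sym em))
      j≡m+t : toℕ j ≡ toℕ m + t
      j≡m+t = begin
        toℕ j              ≡⟨ e ⟩
        toℕ k + u          ≡⟨ cong (_+ u) k≡m+s ⟩
        (toℕ m + s) + u    ≡⟨ +-assoc (toℕ m) s u ⟩
        toℕ m + (s + u)    ≡⟨ cong (toℕ m +_) (m+[n∸m]≡n (<⇒≤ s<t)) ⟩
        toℕ m + t          ∎

  translate-difference-early : ∀ {k j : Fin ℓ} → toℕ k + t < ℓ → toℕ j ≡ toℕ k + u →
                               g ⟨$⟩ˡ (h ⟨$⟩ʳ p k) ≡ p j
  translate-difference-early {k} {j} k+t<ℓ e =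
    trans (cong (g ⟨$⟩ˡ_) (hp k k+t (toℕ-fromℕ< k+t<ℓ))) (translate⁻¹ g gp k+t≡j+s)
    where
      open ≡-Reasoning
      k+t = fromℕ< k+t<ℓ
      k+t≡j+s : toℕ k+t ≡ toℕ j + s
      k+t≡j+s = begin
        toℕ k+t            ≡⟨ toℕ-fromℕ< k+t<ℓ ⟩
        toℕ k + t          ≡⟨ cong (toℕ k +_) (sym (m∸n+n≡m (<⇒≤ s<t))) ⟩
        toℕ k + (u + s)    ≡⟨ sym (+-assoc (toℕ k) u s) ⟩
        (toℕ k + u) + s    ≡⟨ cong (_+ s) (sym e) ⟩
        toℕ j + s          ∎

  private
    room-for-t : ∀ {x} → x < suc q * s → x + t < ℓ
    room-for-t x< = <-≤-trans (+-monoˡ-< t x<) bound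

  translate-difference-start : ∀ {k j : Fin ℓ} → toℕ k < s → toℕ j ≡ toℕ k + u →
                               h ⟨$⟩ʳ (g ⟨$⟩ˡ p k) ≡ p j
  translate-difference-start {k} {j} k<s e
    with letter-recurs g gp (≤-trans (m≤m+n _ t) bound) k k<s
  ... | d , 1≤d , d≤q , y , ey , pk≡py = begin
      h ⟨$⟩ʳ (g ⟨$⟩ˡ p k)   ≡⟨ cong (λ c → h ⟨$⟩ʳ (g ⟨$⟩ˡ c)) pk≡py ⟩
      h ⟨$⟩ʳ (g ⟨$⟩ˡ p y)   ≡⟨ translate-difference-late s≤y (toℕ-fromℕ< y+u<ℓ) ⟩
      p y+u                  ≡⟨ sym (translate-difference-early y+t<ℓ (toℕ-fromℕ< y+u<ℓ)) ⟩
      g ⟨$⟩ˡ (h ⟨$⟩ʳ p y)   ≡⟨ cong (λ c → g ⟨$⟩ˡ (h ⟨$⟩ʳ c)) (sym pk≡py) ⟩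
      g ⟨$⟩ˡ (h ⟨$⟩ʳ p k)   ≡⟨ translate-difference-early k+t<ℓ e ⟩
      p j                    ∎
    where
      open ≡-Reasoning
      s≤y : s ≤ toℕ y
      s≤y = subst (s ≤_) (sym ey)
              (≤-trans (subst (_≤ d * s) (*-identityˡ s) (*-monoˡ-≤ s 1≤d)) (m≤n+m (d * s) (toℕ k)))
      y+t<ℓ : toℕ y + t < ℓ
      y+t<ℓ = subst (λ x → x + t < ℓ) (sym ey) (room-for-t (offset< k<s d≤q))
      y+u<ℓ : toℕ y + u < ℓ
      y+u<ℓ = ≤-<-trans (+-monoʳ-≤ (toℕ y) (m∸n≤m t s)) y+t<ℓ
      y+u = fromℕ< y+u<ℓ
      k+t<ℓ : toℕ k + t < ℓ
      k+t<ℓ = room-for-t (<-≤-trans k<s (m≤m+n s (q * s)))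

  translates-difference : Translates (flip g ∘ₚ h) p (t ∸ s)
  translates-difference k j e with s ≤? toℕ k
  ... | yes s≤k = translate-difference-late s≤k e
  ... | no s≰k  = translate-difference-start (≰⇒> s≰k) e

mainTheorem17 : (q : ℕ) (G : Subgroup q) (ℓ : ℕ) (p : Word q ℓ) →
    IsPattern G p → (s t : ℕ) → s < t → suc q * s + t ≤ ℓ →
    HasPeriod G p s → HasPeriod G p t → HasPeriod G p (t ∸ s)
mainTheorem17 q G ℓ p _ s t s<t bound (_ , _ , g , g∈G , gp) (_ , t<ℓ , h , h∈G , hp) =
  m<n⇒0<n∸m s<t , ≤-<-trans (m∸n≤m t s) t<ℓ ,
  flip g ∘ₚ h , has-∘ G (has-inv G g∈G) h∈G , translates-difference g h s<t bound gp hp
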